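{- Let $\pi=\pi_1\cdots\pi_n$ be a plus irreducible permutation of length $n$, and let $I=\{i,j,k\}$ with $1\le i\le j\le k\le n$ be a multiset of indices of $\pi$ of cardinality $3$. Then $\tilde{\pi}_I$ is a plus irreducible permutation of length $n+3$. Moreover, if $\pi_1=1$ and $\pi_n=n$, then $(\tilde{\pi}_I)_1=1$ and $(\tilde{\pi}_I)_{n+3}=n+3$.
   Context: Permutations are written in one-line notation. A permutation $\pi=\pi_1\cdots\pi_n$ is plus irreducible if $\pi_{t+1}\neq \pi_t+1$ for all $t=1,\ldots,n-1$. A block transposition of $\sigma=\sigma_1\cdots\sigma_m$ with indices $1\le p<q<r\le m+1$ produces $\sigma_1\cdots\sigma_{p-1}\,\sigma_q\cdots\sigma_{r-1}\,\sigma_p\cdots\sigma_{q-1}\,\sigma_r\cdots\sigma_m$ (the adjacent blocks in positions $p,\ldots,q-1$ and $q,\ldots,r-1$ are interchanged). Given $\pi$ and the multiset $I=\{i,j,k\}$ with $i\le j\le k$, the permutation $\pi_I$ (of length $n+3$) is obtained from $\pi$ by replacing the entries at positions $i,j,k$ with increasing runs of consecutive values, rescaling all entries so as to keep the relative order of the entries of $\pi$: if $i,j,k$ are distinct, each of $\pi_i,\pi_j,\pi_k$ is replaced by a run of length $2$; if exactly two of the indices coincide, the entry at the repeated index is replaced by a run of length $3$ and the other by a run of length $2$; if $i=j=k$, $\pi_i$ is replaced by a run of length $4$. Then $\tilde{\pi}_I$ is the permutation obtained from $\pi_I$ by applying the block transposition with indices $i+1,\,j+2,\,k+3$. (Example: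 $\pi=1324$, $I=\{2,2,4\}$ gives $\pi_I=1345267$ and $\tilde\pi_I=1352647$.) -}

module Defs where

open import Data.Nat using (ℕ; zero; suc; _+_; _∸_; _<ᵇ_; _≡ᵇ_)
open import Data.Bool using (Bool; true; false; if_then_else_)
open import Data.List using (List; []; _∷_; _++_; map; upTo; zip; length; take; drop; concatMap; filter)
open import Data.Product using (_×_; _,_; proj₁; proj₂)
open import Data.List.Relation.Unary.Linked using (Linked)
open import Data.List.Relation.Binary.Permutation.Propositional using (_↭_)
open import Relation.Binary.PropositionalEquality using (_≡_; _≢_)
open import Relation.Nullary.Decidable using (does)
open import Data.Nat.Properties using (_≟_)
open import Data.Nat.ListAction using (sum)

oneToN : ℕ → List ℕ
oneToN n = map suc (upTo n)

IsPerm : ℕ → List ℕ → Set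
IsPerm n π = π ↭ oneToN n

PlusIrreducible : List ℕ → Set
PlusIrreducible π = Linked (λ a b → b ≢ suc a) π

indexed : List ℕ → List (ℕ × ℕ)
indexed π = zip (map suc (upTo (length π))) π

mult : ℕ → ℕ → ℕ → ℕ → ℕ
mult i j k t = length (filter (λ x → x ≟ t) (i ∷ j ∷ k ∷ []))

runLen : ℕ → ℕ → ℕ → ℕ → ℕ
runLen i j k t = suc (mult i j k t)

run : ℕ → ℕ → List ℕ
run b m = map (λ x → b + suc x) (upTo m)

-- π_I : entry π_t (at position t) is replaced by the run of length runLen t,
-- rescaled: its first value is 1 + the total length of the runs of all entries
-- of π smaller than π_t.
inflate : ℕ → ℕ → ℕ → List ℕ → List ℕ
inflate i j k π = concatMap piece (indexed π)
  where
  below : ℕ → ℕ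
  below v = sum (map (λ sp → if proj₂ sp <ᵇ v then runLen i j k (proj₁ sp) else 0) (indexed π))
  piece : ℕ × ℕ → List ℕ
  piece (t , v) = run (below v) (runLen i j k t)

-- block transposition with indices p < q < r (1-indexed)
blockTransposition : ℕ → ℕ → ℕ → List ℕ → List ℕ
blockTransposition p q r σ =
  take (p ∸ 1) σ ++ take (r ∸ q) (drop (q ∸ 1) σ) ++ take (q ∸ p) (drop (p ∸ 1) σ) ++ drop (r ∸ 1) σ

tilde : ℕ → ℕ → ℕ → List ℕ → List ℕ
tilde i j k π = blockTransposition (i + 1) (j + 2) (k + 3) (inflate i j k π)

-- Mark each entry of σ = π_I by whether it starts one of the runs replacing the entries of π.  The run of
-- π_{t+1} begins with the successor of the last entry of the run of π_t only if π_{t+1} = π_t + 1, so for plus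
-- irreducible π the successor steps of σ are exactly its continuation entries, which sit at the three positions
-- where the enlarged runs of π_i, π_j, π_k continue.  These are precisely the cuts of the block transposition,
-- so σ = A C B D where no block contains a successor step and each of C, B, D starts with the successor of the
-- last entry of the block before it.  In A B C D a junction could then only be a successor step if two of the
-- first entries of C, B, D were equal.  The runs of the values 1 and n start and end σ, and A and D stay in place.
module Submission where

open import Defs
open import Data.Bool using (Bool; true; false; if_then_else_)
open import Data.Empty using (⊥-elim)
open import Data.List using (List; []; _∷_; _++_; _∷ʳ_; [_]; map; concatMap; replicate; filter; take; drop; length; head; last; upTo; applyUpTo; zip; initLast; _∷ʳ′_)
open import Data.List.Properties using (++-assoc; ++-identityʳ; map-++; length-map; length-++; length-replicate; concatMap-++; drop-drop; map-applyUpTo; map-upTo; map-cong; length-upTo; upTo-∷ʳ; filter-accept; filter-reject; ∷-injectiveʳ)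
open import Data.List.Membership.Propositional using (_∈_)
open import Data.List.Membership.Propositional.Properties using (∈-map⁺; ∈-map⁻; ∈-++⁺ˡ; ∈-++⁺ʳ; ∈-∃++; ∈-upTo⁺; ∈-upTo⁻)
open import Data.List.Relation.Unary.All as All using (All; []; _∷_)
open import Data.List.Relation.Unary.Any using (here; there)
open import Data.List.Relation.Unary.Linked using (Linked; []; [-]; _∷_; _∷′_)
import Data.List.Relation.Unary.Linked.Properties as Linked
open import Data.List.Relation.Unary.AllPairs using ([]; _∷_)
open import Data.List.Relation.Unary.Unique.Propositional using (Unique)
import Data.List.Relation.Unary.Unique.Propositional.Properties as Unique
open import Data.List.Relation.Binary.Permutation.Propositional using (_↭_; ↭-refl; ↭-sym; ↭-trans; ↭-reflexive; ↭⇒↭ₛ; module PermutationReasoning)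
open import Data.List.Relation.Binary.Permutation.Propositional.Properties using (∈-resp-↭; drop-mid; ↭-empty-inv; ++⁺ˡ; ++⁺ʳ; ++-comm; shifts; ↭-length)
import Data.List.Relation.Binary.Permutation.Setoid.Properties as Permutationₛ
open import Data.Maybe using (Maybe; just)
open import Data.Maybe.Properties using (just-injective)
open import Data.Maybe.Relation.Binary.Connected using (Connected; just; just-nothing; nothing-just)
open import Data.Nat using (ℕ; zero; suc; _+_; _∸_; _≤_; _<_; _<ᵇ_; z≤n; s≤s; z<s; _≤?_)
open import Data.Nat.ListAction using (sum)
open import Data.Nat.ListAction.Properties using (sum-++)
open import Data.Nat.Properties
open import Data.Nat.Tactic.RingSolver using (solve-∀)
open import Function using (_∘_)
open import Data.Product using (_×_; _,_; proj₁; proj₂; ∃; ∃₂)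
open import Relation.Nullary using (yes; no)
open import Relation.Binary.PropositionalEquality using (_≡_; _≢_; ≢-sym; refl; sym; trans; cong; cong₂; subst; subst₂; setoid; module ≡-Reasoning)

private variable
  E : Set
  x y : E
  ys : List E

take-++-length : ∀ (xs : List E) ys → take (length xs) (xs ++ ys) ≡ xs
take-++-length []       ys = refl
take-++-length (x ∷ xs) ys = cong (x ∷_) (take-++-length xs ys)

drop-++-length : ∀ (xs : List E) ys → drop (length xs) (xs ++ ys) ≡ ys
drop-++-length []       ys = refl
drop-++-length (x ∷ xs) ys = drop-++-length xs ys

last-++-∷ : ∀ (xs : List E) y ys → last (xs ++ y ∷ ys) ≡ last (y ∷ ys)
last-++-∷ []            y ys = refl
last-++-∷ (x ∷ [])      y ys = refl
last-++-∷ (x ∷ x′ ∷ xs) y ys = last-++-∷ (x′ ∷ xs) y ys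

Linked-++⁻ : ∀ {R : E → E → Set} xs {ys} → Linked R (xs ++ ys) → Linked R xs × Linked R ys
Linked-++⁻ []                    l       = [] , l
Linked-++⁻ (x ∷ [])      {[]}    [-]     = [-] , []
Linked-++⁻ (x ∷ [])      {_ ∷ _} (_ ∷ l) = [-] , l
Linked-++⁻ (x ∷ x′ ∷ xs)         (r ∷ l) with Linked-++⁻ (x′ ∷ xs) l
... | lxs , lys = r ∷ lxs , lys

Unique-++⁻ʳ : ∀ (xs : List E) → Unique (xs ++ ys) → Unique ys
Unique-++⁻ʳ []       u       = u
Unique-++⁻ʳ (x ∷ xs) (_ ∷ u) = Unique-++⁻ʳ xs u

Unique-++-≢ : ∀ (xs : List E) → Unique (xs ++ ys) → x ∈ xs → y ∈ ys → x ≢ y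
Unique-++-≢ (_ ∷ xs) (x∉ ∷ _) (here refl)  y∈ys = All.lookup x∉ (∈-++⁺ʳ xs y∈ys)
Unique-++-≢ (_ ∷ xs) (_ ∷ u)  (there x∈xs) y∈ys = Unique-++-≢ xs u x∈xs y∈ys

blockTransposition-++ : ∀ (A C B D : List ℕ) {p q r} →
  p ≡ suc (length A) → q ≡ suc (length A + length C) → r ≡ suc (length A + length C + length B) →
  blockTransposition p q r (A ++ C ++ B ++ D) ≡ A ++ B ++ C ++ D
blockTransposition-++ A C B D refl refl refl =
  cong₂ _++_ (take-++-length A _) (cong₂ _++_ block-B (cong₂ _++_ block-C drop-after-B))
  where
  open ≡-Reasoning
  drop-after-C : drop (length A + length C) (A ++ C ++ B ++ D) ≡ B ++ D
  drop-after-C = begin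
    drop (length A + length C) (A ++ C ++ B ++ D)   ≡⟨ drop-drop (length A) (length C) _ ⟨
    drop (length C) (drop (length A) (A ++ C ++ B ++ D)) ≡⟨ cong (drop (length C)) (drop-++-length A _) ⟩
    drop (length C) (C ++ B ++ D)                   ≡⟨ drop-++-length C _ ⟩
    B ++ D                                          ∎
  drop-after-B : drop (length A + length C + length B) (A ++ C ++ B ++ D) ≡ D
  drop-after-B = begin
    drop (length A + length C + length B) (A ++ C ++ B ++ D) ≡⟨ drop-drop (length A + length C) (length B) _ ⟨
    drop (length B) (drop (length A + length C) (A ++ C ++ B ++ D)) ≡⟨ cong (drop (length B)) drop-after-C ⟩
    drop (length B) (B ++ D)                                  ≡⟨ drop-++-length B D ⟩
    D                                                         ∎
  block-B : take (length A + length C + length B ∸ (length A + length C)) (drop (length A + length C) (A ++ C ++ B ++ D)) ≡ B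
  block-B rewrite m+n∸m≡n (length A + length C) (length B) | drop-after-C = take-++-length B D
  block-C : take (length A + length C ∸ length A) (drop (length A) (A ++ C ++ B ++ D)) ≡ C
  block-C rewrite m+n∸m≡n (length A) (length C) | drop-++-length A (C ++ B ++ D) = take-++-length C (B ++ D)

blockTransposition-cuts : ∀ {i′ d₁ d₂} (A C B D : List ℕ) → length A ≡ suc i′ → length C ≡ suc d₁ → length B ≡ suc d₂ →
  let i = suc i′ ; j = i + d₁ ; k = j + d₂ in
  blockTransposition (i + 1) (j + 2) (k + 3) (A ++ C ++ B ++ D) ≡ A ++ B ++ C ++ D
blockTransposition-cuts {i′} {d₁} {d₂} A C B D |A| |C| |B| = blockTransposition-++ A C B D
  (trans (+-comm (suc i′) 1) (cong suc (sym |A|)))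
  (trans (offsets₂ (suc i′) d₁) (cong suc (sym (cong₂ _+_ |A| |C|))))
  (trans (offsets₃ (suc i′) d₁ d₂) (cong suc (sym (cong₂ _+_ (cong₂ _+_ |A| |C|) |B|))))
  where
  offsets₂ : ∀ a b → a + b + 2 ≡ suc (a + suc b)
  offsets₂ = solve-∀
  offsets₃ : ∀ a b c → a + b + c + 3 ≡ suc (a + suc b + suc c)
  offsets₃ = solve-∀

Succ NonSucc : ℕ → ℕ → Set
Succ    a b = b ≡ suc a
NonSucc a b = b ≢ suc a

nonSucc-of-succ : ∀ {m u v} → Connected Succ m (just u) → v ≢ u → Connected NonSucc m (just v)
nonSucc-of-succ (just refl) v≢u = just v≢u
nonSucc-of-succ nothing-just _  = nothing-just

swapBlocks-plusIrreducible : ∀ A C B D {u v w} →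
  PlusIrreducible A → PlusIrreducible (u ∷ C) → PlusIrreducible (v ∷ B) → PlusIrreducible (w ∷ D) →
  Connected Succ (last A) (just u) → Connected Succ (last (u ∷ C)) (just v) → Connected Succ (last (v ∷ B)) (just w) →
  u ≢ v → u ≢ w → v ≢ w →
  PlusIrreducible (A ++ (v ∷ B) ++ (u ∷ C) ++ (w ∷ D))
swapBlocks-plusIrreducible A C B D irrA irrC irrB irrD A→C C→B B→D u≢v u≢w v≢w =
  Linked.++⁺ irrA (nonSucc-of-succ A→C (≢-sym u≢v))
    (Linked.++⁺ irrB (nonSucc-of-succ B→D u≢w)
      (Linked.++⁺ irrC (nonSucc-of-succ C→B (≢-sym v≢w)) irrD))

-- An entry (b , true) of a marked list starts a run, an entry (b , false) continues one.
Marked : Set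
Marked = ℕ × Bool

values : List Marked → List ℕ
values = map proj₁

marks : List Marked → List Bool
marks = map proj₂

SuccMarked : ℕ → Marked → Set
SuccMarked a (b , true)  = NonSucc a b
SuccMarked a (b , false) = Succ a b

MarkedStep : Marked → Marked → Set
MarkedStep p = SuccMarked (proj₁ p)

RunStarts : List Marked → Set
RunStarts = All (λ p → proj₂ p ≡ true)

marks≡replicate⇒RunStarts : ∀ τ {d} → marks τ ≡ replicate d true → RunStarts τ
marks≡replicate⇒RunStarts []                _          = []
marks≡replicate⇒RunStarts ((_ , true) ∷ τ)  {suc d} eq = refl ∷ marks≡replicate⇒RunStarts τ (∷-injectiveʳ eq)
marks≡replicate⇒RunStarts ((_ , false) ∷ τ) {suc d} ()

plusIrreducible-runStarts : ∀ {p ps} → Linked MarkedStep (p ∷ ps) → RunStarts ps → PlusIrreducible (values (p ∷ ps))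
plusIrreducible-runStarts [-]     []         = [-]
plusIrreducible-runStarts (s ∷ l) (refl ∷ st) = s ∷ plusIrreducible-runStarts l st

succ-before-continuation : ∀ ps {u rest} → Linked MarkedStep (ps ++ (u , false) ∷ rest) →
  Connected Succ (last (values ps)) (just u)
succ-before-continuation []           _       = nothing-just
succ-before-continuation (p ∷ [])     (s ∷ _) = just s
succ-before-continuation (p ∷ q ∷ ps) (_ ∷ l) = succ-before-continuation (q ∷ ps) l

splitAtContinuation : ∀ a τ {bs} → marks τ ≡ replicate a true ++ false ∷ bs →
  ∃₂ λ α ρ → ∃ λ u → τ ≡ α ++ (u , false) ∷ ρ × RunStarts α × length α ≡ a × marks ρ ≡ bs
splitAtContinuation zero    []                ()
splitAtContinuation zero    ((u , true) ∷ ρ)  ()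
splitAtContinuation zero    ((u , false) ∷ ρ) refl = [] , ρ , u , refl , [] , refl , refl
splitAtContinuation (suc a) []                ()
splitAtContinuation (suc a) ((v , false) ∷ τ) ()
splitAtContinuation (suc a) ((v , true) ∷ τ)  eq with splitAtContinuation a τ (∷-injectiveʳ eq)
... | α , ρ , u , refl , st , refl , e′ = (v , true) ∷ α , ρ , u , refl , refl ∷ st , refl , e′

swapMarkedBlocks-plusIrreducible : ∀ α γ β δ {u v w} →
  Linked MarkedStep (α ++ (u , false) ∷ γ ++ (v , false) ∷ β ++ (w , false) ∷ δ) →
  Unique (values α ++ (u ∷ values γ) ++ (v ∷ values β) ++ (w ∷ values δ)) →
  RunStarts α → RunStarts γ → RunStarts β → RunStarts δ →
  PlusIrreducible (values α ++ (v ∷ values β) ++ (u ∷ values γ) ++ (w ∷ values δ))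
swapMarkedBlocks-plusIrreducible α γ β δ {u} {v} {w} linked unique stα stγ stβ stδ
  with Linked-++⁻ α linked
... | linked-α , linked-γβδ with Linked-++⁻ ((u , false) ∷ γ) linked-γβδ
... | linked-γ , linked-βδ with Linked-++⁻ ((v , false) ∷ β) linked-βδ
... | linked-β , linked-δ =
  swapBlocks-plusIrreducible (values α) (values γ) (values β) (values δ)
    (irreducible-α linked-α stα)
    (plusIrreducible-runStarts linked-γ stγ)
    (plusIrreducible-runStarts linked-β stβ)
    (plusIrreducible-runStarts linked-δ stδ)
    (succ-before-continuation α linked)
    (succ-before-continuation ((u , false) ∷ γ) linked-γβδ)
    (succ-before-continuation ((v , false) ∷ β) linked-βδ)
    (Unique-++-≢ (u ∷ values γ) unique-γβδ (here refl) (here refl))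
    (Unique-++-≢ (u ∷ values γ) unique-γβδ (here refl) (∈-++⁺ʳ (v ∷ values β) (here refl)))
    (Unique-++-≢ (v ∷ values β) (Unique-++⁻ʳ (u ∷ values γ) unique-γβδ) (here refl) (here refl))
  where
  unique-γβδ : Unique ((u ∷ values γ) ++ (v ∷ values β) ++ (w ∷ values δ))
  unique-γβδ = Unique-++⁻ʳ (values α) unique
  irreducible-α : ∀ {ps} → Linked MarkedStep ps → RunStarts ps → PlusIrreducible (values ps)
  irreducible-α {[]}    _      _        = []
  irreducible-α {_ ∷ _} linked (_ ∷ st) = plusIrreducible-runStarts linked st

-- The continuations sit at the 1-based positions a + 1, a + d₁ + 2, a + d₁ + d₂ + 3, the cuts of the block transposition.
cutMarks : ℕ → ℕ → ℕ → ℕ → List Bool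
cutMarks a d₁ d₂ d₃ = replicate a true ++ false ∷ replicate d₁ true ++ false ∷ replicate d₂ true ++ false ∷ replicate d₃ true

length-replicate-++ : ∀ a {x : E} ys → length (replicate a x ++ ys) ≡ a + length ys
length-replicate-++ zero    ys = refl
length-replicate-++ (suc a) ys = cong suc (length-replicate-++ a ys)

length-cutMarks : ∀ a d₁ d₂ d₃ → length (cutMarks a d₁ d₂ d₃) ≡ a + d₁ + d₂ + d₃ + 3
length-cutMarks a d₁ d₂ d₃ = trans (length-replicate-++ a _) (trans (cong (λ l → a + suc l)
  (trans (length-replicate-++ d₁ _) (cong (λ l → d₁ + suc l)
    (trans (length-replicate-++ d₂ _) (cong (λ l → d₂ + suc l) (length-replicate d₃))))))
  (arithmetic a d₁ d₂ d₃))
  where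
  arithmetic : ∀ a b c d → a + suc (b + suc (c + suc d)) ≡ a + b + c + d + 3
  arithmetic = solve-∀

blockTransposition-cutMarks : ∀ i′ d₁ d₂ d₃ τ {σ} → values τ ≡ σ → Linked MarkedStep τ → Unique σ →
  marks τ ≡ cutMarks (suc i′) d₁ d₂ d₃ →
  let i = suc i′ ; j = i + d₁ ; k = j + d₂ ; σ′ = blockTransposition (i + 1) (j + 2) (k + 3) σ in
  (σ′ ↭ σ × PlusIrreducible σ′) × (head σ′ ≡ head σ × last σ′ ≡ last σ)
blockTransposition-cutMarks i′ d₁ d₂ d₃ τ refl linked unique e
  with splitAtContinuation (suc i′) τ e
... | α@(_ ∷ _) , ρ₁ , u , refl , stα , |α| , e₁ with splitAtContinuation d₁ ρ₁ e₁
... | γ , ρ₂ , v , refl , stγ , |γ| , e₂ with splitAtContinuation d₂ ρ₂ e₂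
... | β , δ , w , refl , stβ , |β| , e₃ =
  (↭-trans (↭-reflexive swapped) (↭-trans (++⁺ˡ A (shifts (v ∷ B) (u ∷ C))) (↭-reflexive (sym split))) ,
   subst PlusIrreducible (sym swapped) irreducible) ,
  (trans (cong head swapped) (cong head (sym split)) ,
   trans (cong last swapped) (trans (last-blocks v B u C) (sym (trans (cong last split) (last-blocks u C v B)))))
  where
  A C B D : List ℕ
  A = values α
  C = values γ
  B = values β
  D = values δ
  split : values (α ++ (u , false) ∷ γ ++ (v , false) ∷ β ++ (w , false) ∷ δ) ≡ A ++ (u ∷ C) ++ (v ∷ B) ++ (w ∷ D)
  split = trans (map-++ proj₁ α _) (cong (λ X → A ++ u ∷ X) (trans (map-++ proj₁ γ _)
            (cong (λ X → C ++ v ∷ X) (map-++ proj₁ β _))))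
  swapped : blockTransposition (suc i′ + 1) (suc i′ + d₁ + 2) (suc i′ + d₁ + d₂ + 3)
              (values (α ++ (u , false) ∷ γ ++ (v , false) ∷ β ++ (w , false) ∷ δ))
            ≡ A ++ (v ∷ B) ++ (u ∷ C) ++ (w ∷ D)
  swapped = trans (cong (blockTransposition (suc i′ + 1) (suc i′ + d₁ + 2) (suc i′ + d₁ + d₂ + 3)) split)
    (blockTransposition-cuts A (u ∷ C) (v ∷ B) (w ∷ D) (trans (length-map proj₁ α) |α|)
      (cong suc (trans (length-map proj₁ γ) |γ|)) (cong suc (trans (length-map proj₁ β) |β|)))
  last-blocks : ∀ a X b Y → last (A ++ (a ∷ X) ++ (b ∷ Y) ++ w ∷ D) ≡ last (w ∷ D)
  last-blocks a X b Y = trans (last-++-∷ A a _) (trans (last-++-∷ (a ∷ X) b _) (last-++-∷ (b ∷ Y) w D))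
  irreducible : PlusIrreducible (A ++ (v ∷ B) ++ (u ∷ C) ++ (w ∷ D))
  irreducible = swapMarkedBlocks-plusIrreducible α γ β δ linked (subst Unique split unique)
                  stα stγ stβ (marks≡replicate⇒RunStarts δ e₃)

run-suc : ∀ c k → run c (suc k) ≡ suc c ∷ run (suc c) k
run-suc c k = cong₂ _∷_ (+-comm c 1) (begin
  map (λ x → c + suc x) (applyUpTo suc k)  ≡⟨ map-applyUpTo suc _ k ⟩
  applyUpTo (λ x → c + suc (suc x)) k      ≡⟨ map-upTo _ k ⟨
  map (λ x → c + suc (suc x)) (upTo k)     ≡⟨ map-cong (λ x → +-suc c (suc x)) (upTo k) ⟩
  run (suc c) k                            ∎)
  where open ≡-Reasoning

run-+ : ∀ c a b → run c (a + b) ≡ run c a ++ run (c + a) b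
run-+ c zero    b = cong (λ c′ → run c′ b) (sym (+-identityʳ c))
run-+ c (suc a) b = begin
  run c (suc a + b)                         ≡⟨ run-suc c (a + b) ⟩
  suc c ∷ run (suc c) (a + b)               ≡⟨ cong (suc c ∷_) (run-+ (suc c) a b) ⟩
  suc c ∷ run (suc c) a ++ run (suc c + a) b ≡⟨ cong₂ (λ X c′ → X ++ run c′ b) (run-suc c a) (+-suc c a) ⟨
  run c (suc a) ++ run (c + suc a) b        ∎
  where open ≡-Reasoning

oneToN-split : ∀ a d → oneToN (suc a + d) ≡ oneToN a ++ suc a ∷ run (suc a) d
oneToN-split a d = begin
  run 0 (suc a + d)                 ≡⟨ cong (run 0) (+-suc a d) ⟨
  run 0 (a + suc d)                 ≡⟨ run-+ 0 a (suc d) ⟩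
  run 0 a ++ run a (suc d)          ≡⟨ cong (run 0 a ++_) (run-suc a d) ⟩
  oneToN a ++ suc a ∷ run (suc a) d ∎
  where open ≡-Reasoning

oneToN-∷ʳ : ∀ n → oneToN (suc n) ≡ oneToN n ++ [ suc n ]
oneToN-∷ʳ n = trans (cong (map suc) (sym (upTo-∷ʳ n))) (map-++ suc (upTo n) [ n ])

length-run : ∀ c k → length (run c k) ≡ k
length-run c k = trans (length-map _ (upTo k)) (length-upTo k)

last-++-run : ∀ xs c k → last (xs ++ run c (suc k)) ≡ just (c + suc k)
last-++-run xs c k = begin
  last (xs ++ run c (suc k))                ≡⟨ cong (λ k′ → last (xs ++ run c k′)) (+-comm 1 k) ⟩
  last (xs ++ run c (k + 1))                ≡⟨ cong (λ X → last (xs ++ X)) (run-+ c k 1) ⟩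
  last (xs ++ run c k ++ [ c + k + 1 ])     ≡⟨ cong last (++-assoc xs (run c k) _) ⟨
  last ((xs ++ run c k) ++ [ c + k + 1 ])   ≡⟨ last-++-∷ (xs ++ run c k) _ [] ⟩
  just (c + k + 1)                          ≡⟨ cong just (trans (+-assoc c k 1) (cong (c +_) (+-comm k 1))) ⟩
  just (c + suc k)                          ∎
  where open ≡-Reasoning

∈-run⁻ : ∀ {t} c k → t ∈ run c k → c < t
∈-run⁻ c k t∈ with _ , _ , refl ← ∈-map⁻ _ t∈ = m<m+n c z<s

∈-oneToN⁻ : ∀ {t} n → t ∈ oneToN n → 1 ≤ t × t ≤ n
∈-oneToN⁻ n t∈ with _ , x<n , refl ← ∈-map⁻ suc t∈ = s≤s z≤n , ∈-upTo⁻ x<n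

∈-oneToN⁺ : ∀ {t} n → 1 ≤ t → t ≤ n → t ∈ oneToN n
∈-oneToN⁺ n (s≤s z≤n) t≤n = ∈-map⁺ suc (∈-upTo⁺ t≤n)

Unique-oneToN : ∀ n → Unique (oneToN n)
Unique-oneToN n = Unique.map⁺ suc-injective (Unique.upTo⁺ n)

Unique-↭ : ∀ {xs ys : List ℕ} → xs ↭ ys → Unique ys → Unique xs
Unique-↭ xs↭ys = Permutationₛ.Unique-resp-↭ (setoid ℕ) (↭⇒↭ₛ (↭-sym xs↭ys))

continuation : ℕ → ℕ → List Marked
continuation c zero    = []
continuation c (suc k) = (suc c , false) ∷ continuation (suc c) k

markedRun : ℕ → ℕ → List Marked
markedRun c k = (suc c , true) ∷ continuation (suc c) k

values-markedRun : ∀ c k → values (markedRun c k) ≡ run c (suc k)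
values-markedRun c k = trans (cong (suc c ∷_) (values-continuation (suc c) k)) (sym (run-suc c k))
  where
  values-continuation : ∀ c k → values (continuation c k) ≡ run c k
  values-continuation c zero    = refl
  values-continuation c (suc k) = trans (cong (suc c ∷_) (values-continuation (suc c) k)) (sym (run-suc c k))

marks-markedRun : ∀ c k → marks (markedRun c k) ≡ true ∷ replicate k false
marks-markedRun c k = cong (true ∷_) (marks-continuation (suc c) k)
  where
  marks-continuation : ∀ c k → marks (continuation c k) ≡ replicate k false
  marks-continuation c zero    = refl
  marks-continuation c (suc k) = cong (false ∷_) (marks-continuation (suc c) k)

runMarks : (ℕ → ℕ) → List ℕ → List Bool
runMarks f = concatMap (λ t → true ∷ replicate (f t) false)

retag : ∀ {a x} {m : Maybe Marked} → Connected SuccMarked (just a) m → Connected MarkedStep (just (a , x)) m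
retag (just r)     = just r
retag just-nothing = just-nothing

linked-markedRun-++ : ∀ c k {rest} → Connected SuccMarked (just (c + suc k)) (head rest) → Linked MarkedStep rest →
  Linked MarkedStep (markedRun c k ++ rest)
linked-markedRun-++ c k {rest} = linked-continuation true (suc c) k ∘ subst (λ a → Connected SuccMarked (just a) (head rest)) (+-suc c k)
  where
  linked-continuation : ∀ x c k {rest} → Connected SuccMarked (just (c + k)) (head rest) → Linked MarkedStep rest →
    Linked MarkedStep ((c , x) ∷ continuation c k ++ rest)
  linked-continuation x c zero {rest} connected linked =
    retag (subst (λ a → Connected SuccMarked (just a) (head rest)) (+-identityʳ c) connected) ∷′ linked
  linked-continuation x c (suc k) {rest} connected linked =
    refl ∷ linked-continuation false (suc c) k (subst (λ a → Connected SuccMarked (just a) (head rest)) (+-suc c k) connected) linked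

-- The entry (t , v) of a list of position–value pairs becomes a run of length suc (m t); for m = mult i j k,
-- inflation (indexed π) is inflate i j k π by definition.
module Runs (m : ℕ → ℕ) where

  value : ℕ × ℕ → ℕ
  value = proj₂

  weight : ℕ × ℕ → ℕ
  weight p = suc (m (proj₁ p))

  contribution : ℕ → ℕ × ℕ → ℕ
  contribution v p = if value p <ᵇ v then weight p else 0

  below : List (ℕ × ℕ) → ℕ → ℕ
  below R v = sum (map (contribution v) R)

  totalWeight : List (ℕ × ℕ) → ℕ
  totalWeight R = sum (map weight R)

  runsOf : List (ℕ × ℕ) → List (ℕ × ℕ) → List ℕ
  runsOf R = concatMap (λ p → run (below R (value p)) (weight p))

  inflation : List (ℕ × ℕ) → List ℕ
  inflation R = runsOf R R

  markedRunsOf : List (ℕ × ℕ) → List (ℕ × ℕ) → List Marked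
  markedRunsOf R = concatMap (λ p → markedRun (below R (value p)) (m (proj₁ p)))

  contribution-< : ∀ {v} p → value p < v → contribution v p ≡ weight p
  contribution-< {v} p lt with value p <ᵇ v | <⇒<ᵇ lt
  ... | true | _ = refl

  contribution-≥ : ∀ {v} p → v ≤ value p → contribution v p ≡ 0
  contribution-≥ {v} p ge with value p <ᵇ v | <ᵇ⇒< (value p) v
  ... | false | _  = refl
  ... | true  | lt = ⊥-elim (≤⇒≯ ge (lt _))

  contribution-mono : ∀ {v w} p → v ≤ w → contribution v p ≤ contribution w p
  contribution-mono {v} {w} p v≤w with value p <ᵇ v | <ᵇ⇒< (value p) v
  ... | false | _  = z≤n
  ... | true  | lt = ≤-reflexive (sym (contribution-< p (<-≤-trans (lt _) v≤w)))

  below-++ : ∀ X Y v → below (X ++ Y) v ≡ below X v + below Y v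
  below-++ X Y v = trans (cong sum (map-++ (contribution v) X Y)) (sum-++ (map (contribution v) X) _)

  totalWeight-++ : ∀ X Y → totalWeight (X ++ Y) ≡ totalWeight X + totalWeight Y
  totalWeight-++ X Y = trans (cong sum (map-++ weight X Y)) (sum-++ (map weight X) _)

  below-mono : ∀ R {v w} → v ≤ w → below R v ≤ below R w
  below-mono []      v≤w = z≤n
  below-mono (p ∷ R) v≤w = +-mono-≤ (contribution-mono p v≤w) (below-mono R v≤w)

  below-+-weight : ∀ R {p v} → p ∈ R → value p < v → below R (value p) + weight p ≤ below R v
  below-+-weight (p ∷ R) {v = v} (here refl) lt
    rewrite contribution-≥ p (≤-refl {value p}) | contribution-< p lt =
    subst (_≤ weight p + below R v) (+-comm (weight p) _) (+-monoʳ-≤ (weight p) (below-mono R (<⇒≤ lt)))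
  below-+-weight (q ∷ R) {p} {v} (there p∈R) lt =
    subst (_≤ contribution v q + below R v) (sym (+-assoc (contribution (value p) q) (below R (value p)) (weight p)))
      (+-mono-≤ (contribution-mono q (<⇒≤ lt)) (below-+-weight R p∈R lt))

  below-all : ∀ R {v} → All (λ p → value p < v) R → below R v ≡ totalWeight R
  below-all []      []         = refl
  below-all (p ∷ R) (lt ∷ lts) = cong₂ _+_ (contribution-< p lt) (below-all R lts)

  below-none : ∀ R {v} → All (λ p → v ≤ value p) R → below R v ≡ 0
  below-none []      []         = refl
  below-none (p ∷ R) (ge ∷ ges) = cong₂ _+_ (contribution-≥ p ge) (below-none R ges)

  runsOf-++ : ∀ R X Y → runsOf R (X ++ Y) ≡ runsOf R X ++ runsOf R Y
  runsOf-++ R = concatMap-++ _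

  runsOf-cong : ∀ R R′ Q → All (λ q → below R (value q) ≡ below R′ (value q)) Q → runsOf R Q ≡ runsOf R′ Q
  runsOf-cong R R′ []      []         = refl
  runsOf-cong R R′ (q ∷ Q) (eq ∷ eqs) = cong₂ (λ b rest → run b (weight q) ++ rest) eq (runsOf-cong R R′ Q eqs)

  length-runsOf : ∀ R Q → length (runsOf R Q) ≡ totalWeight Q
  length-runsOf R []      = refl
  length-runsOf R (q ∷ Q) = trans (length-++ (run (below R (value q)) (weight q)))
    (cong₂ _+_ (length-run (below R (value q)) (weight q)) (length-runsOf R Q))

  values-markedRunsOf : ∀ R Q → values (markedRunsOf R Q) ≡ runsOf R Q
  values-markedRunsOf R []      = refl
  values-markedRunsOf R (q ∷ Q) = trans (map-++ proj₁ (markedRun (below R (value q)) (m (proj₁ q))) _)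
    (cong₂ _++_ (values-markedRun _ _) (values-markedRunsOf R Q))

  marks-markedRunsOf : ∀ R Q → marks (markedRunsOf R Q) ≡ runMarks m (map proj₁ Q)
  marks-markedRunsOf R []      = refl
  marks-markedRunsOf R (q ∷ Q) = trans (map-++ proj₂ (markedRun (below R (value q)) (m (proj₁ q))) _)
    (cong₂ _++_ (marks-markedRun _ _) (marks-markedRunsOf R Q))

  module _ {n R} (values↭ : map value R ↭ oneToN n) where

    value-range : ∀ {p} → p ∈ R → 1 ≤ value p × value p ≤ n
    value-range p∈R = ∈-oneToN⁻ n (∈-resp-↭ values↭ (∈-map⁺ value p∈R))

    value-exists : ∀ {v} → 1 ≤ v → v ≤ n → ∃ λ p → p ∈ R × value p ≡ v
    value-exists 1≤v v≤n with p , p∈R , refl ← ∈-map⁻ value (∈-resp-↭ (↭-sym values↭) (∈-oneToN⁺ n 1≤v v≤n)) =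
      p , p∈R , refl


    below-+-weight-< : ∀ {p q} → p ∈ R → q ∈ R → suc (value p) < value q → below R (value p) + weight p < below R (value q)
    below-+-weight-< {p} {q} p∈R q∈R p+1<q
      with r , r∈R , r≡ ← value-exists (s≤s z≤n) (≤-trans (<⇒≤ p+1<q) (proj₂ (value-range q∈R))) =
      begin-strict
        below R (value p) + weight p  ≤⟨ below-+-weight R p∈R (n<1+n (value p)) ⟩
        below R (suc (value p))       ≡⟨ cong (below R) r≡ ⟨
        below R (value r)             <⟨ m<m+n _ z<s ⟩
        below R (value r) + weight r  ≤⟨ below-+-weight R r∈R (subst (_< value q) (sym r≡) p+1<q) ⟩
        below R (value q)             ∎
      where open ≤-Reasoning

    below-junction : ∀ {p q} → p ∈ R → q ∈ R → value q ≢ suc (value p) → below R (value q) ≢ below R (value p) + weight p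
    below-junction {p} {q} p∈R q∈R q≢ with value q ≤? value p
    ... | yes q≤p = <⇒≢ (≤-<-trans (below-mono R q≤p) (m<m+n _ z<s))
    ... | no  q≰p = ≢-sym (<⇒≢ (below-+-weight-< p∈R q∈R (≤∧≢⇒< (≰⇒> q≰p) (≢-sym q≢))))

    markedRunsOf-linked : ∀ Q → All (_∈ R) Q → PlusIrreducible (map value Q) → Linked MarkedStep (markedRunsOf R Q)
    markedRunsOf-linked []          _                     _          = []
    markedRunsOf-linked (p ∷ [])    _                     _          = linked-markedRun-++ _ _ just-nothing []
    markedRunsOf-linked (p ∷ q ∷ Q) (p∈R ∷ q∈R ∷ Q⊆R) (q≢ ∷ irr) =
      linked-markedRun-++ _ _ (just λ e → below-junction p∈R q∈R q≢ (suc-injective e))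
        (markedRunsOf-linked (q ∷ Q) (q∈R ∷ Q⊆R) irr)

  -- Induction on n: the entry of value n has the run S + 1, …, S + w, where S is the total weight of the others.
  inflation-↭ : ∀ n R → map value R ↭ oneToN n → inflation R ↭ oneToN (totalWeight R)
  inflation-↭ zero    []      _ = ↭-refl
  inflation-↭ zero    (_ ∷ _) values↭ with () ← ↭-empty-inv values↭
  inflation-↭ (suc n) R values↭ with value-exists values↭ (s≤s z≤n) ≤-refl
  ... | p , p∈R , value≡ with R₁ , R₂ , refl ← ∈-∃++ p∈R = begin
    inflation R
      ≡⟨ runsOf-++ R R₁ (p ∷ R₂) ⟩
    runsOf R R₁ ++ run (below R (value p)) (weight p) ++ runsOf R R₂
      ≡⟨ cong₂ (λ X Y → X ++ run (below R (value p)) (weight p) ++ Y)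
               (runsOf-cong R R′ R₁ (All.tabulate λ q∈ → below-removed (m≤n⇒m≤1+n (proj₂ (value-range values↭′ (∈-++⁺ˡ q∈))))))
               (runsOf-cong R R′ R₂ (All.tabulate λ q∈ → below-removed (m≤n⇒m≤1+n (proj₂ (value-range values↭′ (∈-++⁺ʳ R₁ q∈)))))) ⟩
    runsOf R′ R₁ ++ run (below R (value p)) (weight p) ++ runsOf R′ R₂
      ≡⟨ cong (λ b → runsOf R′ R₁ ++ run b (weight p) ++ runsOf R′ R₂) below-p ⟩
    runsOf R′ R₁ ++ run S (weight p) ++ runsOf R′ R₂
      ↭⟨ ++⁺ˡ (runsOf R′ R₁) (++-comm (run S (weight p)) (runsOf R′ R₂)) ⟩
    runsOf R′ R₁ ++ runsOf R′ R₂ ++ run S (weight p)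
      ≡⟨ ++-assoc (runsOf R′ R₁) _ _ ⟨
    (runsOf R′ R₁ ++ runsOf R′ R₂) ++ run S (weight p)
      ≡⟨ cong (_++ run S (weight p)) (runsOf-++ R′ R₁ R₂) ⟨
    inflation R′ ++ run S (weight p)
      ↭⟨ ++⁺ʳ (run S (weight p)) (inflation-↭ n R′ values↭′) ⟩
    oneToN S ++ run S (weight p)
      ≡⟨ run-+ 0 S (weight p) ⟨
    oneToN (S + weight p)
      ≡⟨ cong oneToN total ⟩
    oneToN (totalWeight R) ∎
    where
    open PermutationReasoning
    R′ : List (ℕ × ℕ)
    R′ = R₁ ++ R₂
    S : ℕ
    S = totalWeight R′
    values↭′ : map value R′ ↭ oneToN n
    values↭′ = subst₂ _↭_ (sym (map-++ value R₁ R₂)) (++-identityʳ (oneToN n))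
      (drop-mid (map value R₁) (oneToN n)
        (subst₂ _↭_ (trans (map-++ value R₁ (p ∷ R₂)) (cong (λ v → map value R₁ ++ v ∷ map value R₂) value≡))
                    (oneToN-∷ʳ n) values↭))
    below-removed : ∀ {v} → v ≤ suc n → below R v ≡ below R′ v
    below-removed {v} v≤ = trans (below-++ R₁ (p ∷ R₂) v)
      (trans (cong (λ c → below R₁ v + (c + below R₂ v)) (contribution-≥ p (subst (v ≤_) (sym value≡) v≤)))
             (sym (below-++ R₁ R₂ v)))
    below-p : below R (value p) ≡ S
    below-p = trans (below-removed (≤-reflexive value≡))
      (below-all R′ (All.tabulate λ {q} q∈ → subst (value q <_) (sym value≡) (s≤s (proj₂ (value-range values↭′ q∈)))))
    total : S + weight p ≡ totalWeight R
    total = trans (cong (_+ weight p) (totalWeight-++ R₁ R₂))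
      (trans (trans (+-assoc (totalWeight R₁) _ _) (cong (totalWeight R₁ +_) (+-comm (totalWeight R₂) (weight p))))
             (sym (totalWeight-++ R₁ (p ∷ R₂))))

  head-inflation : ∀ {n} R → map value R ↭ oneToN n → head (map value R) ≡ just 1 → head (inflation R) ≡ just 1
  head-inflation (p ∷ R) values↭ head≡ = cong (λ b → just (b + 1))
    (trans (cong (below (p ∷ R)) (just-injective head≡))
           (below-none (p ∷ R) (All.tabulate λ q∈ → proj₁ (value-range values↭ q∈))))

  last-inflation : ∀ {n} R → map value R ↭ oneToN n → last (map value R) ≡ just n → last (inflation R) ≡ just (totalWeight R)
  last-inflation R values↭ last≡ with initLast R
  last-inflation .[]               values↭ ()    | []
  last-inflation {n} .(R′ ∷ʳ p) values↭ last≡ | R′ ∷ʳ′ p = begin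
    last (inflation (R′ ∷ʳ p))                     ≡⟨ cong last (runsOf-++ (R′ ∷ʳ p) R′ [ p ]) ⟩
    last (runsOf (R′ ∷ʳ p) R′ ++ run b (weight p) ++ []) ≡⟨ cong (λ X → last (runsOf (R′ ∷ʳ p) R′ ++ X)) (++-identityʳ _) ⟩
    last (runsOf (R′ ∷ʳ p) R′ ++ run b (weight p)) ≡⟨ last-++-run (runsOf (R′ ∷ʳ p) R′) b (m (proj₁ p)) ⟩
    just (b + weight p)                            ≡⟨ cong (λ b → just (b + weight p)) below-last ⟩
    just (totalWeight R′ + weight p)               ≡⟨ cong just total ⟨
    just (totalWeight (R′ ∷ʳ p))                   ∎
    where
    open ≡-Reasoning
    b : ℕ
    b = below (R′ ∷ʳ p) (value p)
    value≡ : value p ≡ n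
    value≡ = just-injective (trans (sym (trans (cong last (map-++ value R′ [ p ])) (last-++-∷ (map value R′) (value p) []))) last≡)
    unique : Unique (map value R′ ++ [ value p ])
    unique = subst Unique (map-++ value R′ [ p ]) (Unique-↭ values↭ (Unique-oneToN n))
    below-last : b ≡ totalWeight R′
    below-last = trans (below-++ R′ [ p ] (value p))
      (trans (cong (below R′ (value p) +_) (cong (_+ 0) (contribution-≥ p (≤-refl {value p}))))
      (trans (+-identityʳ _) (below-all R′ (All.tabulate λ {q} q∈ →
        ≤∧≢⇒< (subst (value q ≤_) (sym value≡) (proj₂ (value-range values↭ (∈-++⁺ˡ q∈))))
              (Unique-++-≢ (map value R′) unique (∈-map⁺ value q∈) (here refl))))))
    total : totalWeight (R′ ∷ʳ p) ≡ totalWeight R′ + weight p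
    total = trans (totalWeight-++ R′ [ p ]) (cong (totalWeight R′ +_) (+-identityʳ (weight p)))

  totalWeight-runMarks : ∀ R → totalWeight R ≡ length (runMarks m (map proj₁ R))
  totalWeight-runMarks R = begin
    totalWeight R                             ≡⟨ length-runsOf R R ⟨
    length (inflation R)                      ≡⟨ cong length (values-markedRunsOf R R) ⟨
    length (values (markedRunsOf R R))        ≡⟨ length-map proj₁ (markedRunsOf R R) ⟩
    length (markedRunsOf R R)                 ≡⟨ length-map proj₂ (markedRunsOf R R) ⟨
    length (marks (markedRunsOf R R))         ≡⟨ cong length (marks-markedRunsOf R R) ⟩
    length (runMarks m (map proj₁ R))         ∎
    where open ≡-Reasoning

  blockTransposition-inflation : ∀ {n R} → map value R ↭ oneToN n → PlusIrreducible (map value R) →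
    ∀ i′ d₁ d₂ d₃ → runMarks m (map proj₁ R) ≡ cutMarks (suc i′) d₁ d₂ d₃ →
    let i = suc i′ ; j = i + d₁ ; k = j + d₂ ; σ = inflation R ; σ′ = blockTransposition (i + 1) (j + 2) (k + 3) σ in
    (σ′ ↭ σ × PlusIrreducible σ′) × (head σ′ ≡ head σ × last σ′ ≡ last σ)
  blockTransposition-inflation {n} {R} values↭ irreducible i′ d₁ d₂ d₃ marks≡ =
    blockTransposition-cutMarks i′ d₁ d₂ d₃ (markedRunsOf R R) (values-markedRunsOf R R)
      (markedRunsOf-linked values↭ R (All.tabulate λ p∈ → p∈) irreducible)
      (Unique-↭ (inflation-↭ n R values↭) (Unique-oneToN (totalWeight R)))
      (trans (marks-markedRunsOf R R) marks≡)

multiplicity : List ℕ → ℕ → ℕ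
multiplicity as t = length (filter (_≟ t) as)

multiplicity-here : ∀ t as → multiplicity (t ∷ as) t ≡ suc (multiplicity as t)
multiplicity-here t as = cong length (filter-accept (_≟ t) refl)

multiplicity-there : ∀ {a t} as → a ≢ t → multiplicity (a ∷ as) t ≡ multiplicity as t
multiplicity-there {t = t} as a≢t = cong length (filter-reject (_≟ t) a≢t)

-- Leaves bs unchanged if it has fewer than q trues.
insertFalseAfter : ℕ → List Bool → List Bool
insertFalseAfter zero    bs           = false ∷ bs
insertFalseAfter (suc q) []           = []
insertFalseAfter (suc q) (true ∷ bs)  = true ∷ insertFalseAfter q bs
insertFalseAfter (suc q) (false ∷ bs) = false ∷ insertFalseAfter (suc q) bs

insertFalseAfter-trues : ∀ a d bs → insertFalseAfter a (replicate (a + d) true ++ bs) ≡ replicate a true ++ false ∷ replicate d true ++ bs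
insertFalseAfter-trues zero    d bs = refl
insertFalseAfter-trues (suc a) d bs = cong (true ∷_) (insertFalseAfter-trues a d bs)

insertFalseAfter-falses : ∀ q r bs → insertFalseAfter (suc q) (replicate r false ++ bs) ≡ replicate r false ++ insertFalseAfter (suc q) bs
insertFalseAfter-falses q zero    bs = refl
insertFalseAfter-falses q (suc r) bs = cong (false ∷_) (insertFalseAfter-falses q r bs)

insertFalseAfter-runMarks : ∀ f ts q bs →
  insertFalseAfter (suc (length ts + q)) (runMarks f ts ++ bs) ≡ runMarks f ts ++ insertFalseAfter (suc q) bs
insertFalseAfter-runMarks f []       q bs = refl
insertFalseAfter-runMarks f (t ∷ ts) q bs = cong (true ∷_) (begin
  insertFalseAfter (suc (length ts + q)) ((replicate (f t) false ++ runMarks f ts) ++ bs)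
    ≡⟨ cong (insertFalseAfter _) (++-assoc (replicate (f t) false) _ bs) ⟩
  insertFalseAfter (suc (length ts + q)) (replicate (f t) false ++ runMarks f ts ++ bs)
    ≡⟨ insertFalseAfter-falses (length ts + q) (f t) _ ⟩
  replicate (f t) false ++ insertFalseAfter (suc (length ts + q)) (runMarks f ts ++ bs)
    ≡⟨ cong (replicate (f t) false ++_) (insertFalseAfter-runMarks f ts q bs) ⟩
  replicate (f t) false ++ runMarks f ts ++ insertFalseAfter (suc q) bs
    ≡⟨ ++-assoc (replicate (f t) false) _ _ ⟨
  (replicate (f t) false ++ runMarks f ts) ++ insertFalseAfter (suc q) bs ∎)
  where open ≡-Reasoning

runMarks-cong : ∀ {f g} ts → All (λ t → f t ≡ g t) ts → runMarks f ts ≡ runMarks g ts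
runMarks-cong []       []         = refl
runMarks-cong (t ∷ ts) (eq ∷ eqs) = cong₂ (λ r rest → (true ∷ replicate r false) ++ rest) eq (runMarks-cong ts eqs)

runMarks-multiplicity-[] : ∀ ts → runMarks (multiplicity []) ts ≡ replicate (length ts) true
runMarks-multiplicity-[] []       = refl
runMarks-multiplicity-[] (t ∷ ts) = cong (true ∷_) (runMarks-multiplicity-[] ts)

runMarks-multiplicity-∷ : ∀ as {a n} → 1 ≤ a → a ≤ n →
  runMarks (multiplicity (a ∷ as)) (oneToN n) ≡ insertFalseAfter a (runMarks (multiplicity as) (oneToN n))
runMarks-multiplicity-∷ as {suc a} (s≤s z≤n) a≤n with d , refl ← m≤n⇒∃[o]m+o≡n a≤n = begin
  runMarks g (oneToN (suc a + d))
    ≡⟨ cong (runMarks g) (oneToN-split a d) ⟩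
  runMarks g (oneToN a ++ suc a ∷ run (suc a) d)
    ≡⟨ concatMap-++ _ (oneToN a) _ ⟩
  runMarks g (oneToN a) ++ (true ∷ replicate (g (suc a)) false) ++ runMarks g (run (suc a) d)
    ≡⟨ cong₂ _++_ (runMarks-cong (oneToN a) (All.tabulate λ t∈ → multiplicity-there as (≢-sym (<⇒≢ (s≤s (proj₂ (∈-oneToN⁻ a t∈)))))))
         (cong₂ (λ r rest → (true ∷ replicate r false) ++ rest) (multiplicity-here (suc a) as)
           (runMarks-cong (run (suc a) d) (All.tabulate λ t∈ → multiplicity-there as (<⇒≢ (∈-run⁻ (suc a) d t∈))))) ⟩
  runMarks f (oneToN a) ++ (true ∷ false ∷ replicate (f (suc a)) false) ++ runMarks f (run (suc a) d)
    ≡⟨ insertFalseAfter-runMarks f (oneToN a) 0 _ ⟨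
  insertFalseAfter (suc (length (oneToN a) + 0)) (runMarks f (oneToN a) ++ (true ∷ replicate (f (suc a)) false) ++ runMarks f (run (suc a) d))
    ≡⟨ cong₂ insertFalseAfter (cong suc (trans (+-identityʳ _) (length-run 0 a))) (sym (concatMap-++ _ (oneToN a) _)) ⟩
  insertFalseAfter (suc a) (runMarks f (oneToN a ++ suc a ∷ run (suc a) d))
    ≡⟨ cong (λ ts → insertFalseAfter (suc a) (runMarks f ts)) (oneToN-split a d) ⟨
  insertFalseAfter (suc a) (runMarks f (oneToN (suc a + d))) ∎
  where
  open ≡-Reasoning
  f g : ℕ → ℕ
  f = multiplicity as
  g = multiplicity (suc a ∷ as)

runMarks-mult : ∀ i′ d₁ d₂ d₃ → let i = suc i′ ; j = i + d₁ ; k = j + d₂ in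
  runMarks (mult i j k) (oneToN (k + d₃)) ≡ cutMarks i d₁ d₂ d₃
runMarks-mult i′ d₁ d₂ d₃ = begin
  runMarks (multiplicity (i ∷ j ∷ k ∷ [])) (oneToN n)
    ≡⟨ runMarks-multiplicity-∷ (j ∷ k ∷ []) (s≤s z≤n) i≤n ⟩
  ins i (runMarks (multiplicity (j ∷ k ∷ [])) (oneToN n))
    ≡⟨ cong (ins i) (runMarks-multiplicity-∷ (k ∷ []) (s≤s z≤n) j≤n) ⟩
  ins i (ins j (runMarks (multiplicity (k ∷ [])) (oneToN n)))
    ≡⟨ cong (ins i ∘ ins j) (runMarks-multiplicity-∷ [] (s≤s z≤n) k≤n) ⟩
  ins i (ins j (ins k (runMarks (multiplicity []) (oneToN n))))
    ≡⟨ cong (ins i ∘ ins j ∘ ins k) (trans (runMarks-multiplicity-[] (oneToN n)) (cong (λ l → replicate l true) (length-run 0 n))) ⟩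
  ins i (ins j (ins k (replicate n true)))
    ≡⟨ cong (ins i ∘ ins j ∘ ins k) (++-identityʳ (replicate n true)) ⟨
  ins i (ins j (ins k (replicate (k + d₃) true ++ [])))
    ≡⟨ cong (ins i ∘ ins j) (insertFalseAfter-trues k d₃ []) ⟩
  ins i (ins j (replicate (j + d₂) true ++ false ∷ replicate d₃ true ++ []))
    ≡⟨ cong (ins i) (insertFalseAfter-trues j d₂ _) ⟩
  ins i (replicate (i + d₁) true ++ false ∷ replicate d₂ true ++ false ∷ replicate d₃ true ++ [])
    ≡⟨ insertFalseAfter-trues i d₁ _ ⟩
  replicate i true ++ false ∷ replicate d₁ true ++ false ∷ replicate d₂ true ++ false ∷ replicate d₃ true ++ []
    ≡⟨ cong (λ X → replicate i true ++ false ∷ replicate d₁ true ++ false ∷ replicate d₂ true ++ false ∷ X) (++-identityʳ _) ⟩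
  cutMarks i d₁ d₂ d₃ ∎
  where
  open ≡-Reasoning
  ins = insertFalseAfter
  i j k n : ℕ
  i = suc i′
  j = i + d₁
  k = j + d₂
  n = k + d₃
  k≤n : k ≤ n
  k≤n = m≤m+n k d₃
  j≤n : j ≤ n
  j≤n = ≤-trans (m≤m+n j d₂) k≤n
  i≤n : i ≤ n
  i≤n = ≤-trans (m≤m+n i d₁) j≤n

map-proj₁-zip : ∀ {F : Set} (xs : List E) (ys : List F) → length xs ≡ length ys → map proj₁ (zip xs ys) ≡ xs
map-proj₁-zip []       []       _  = refl
map-proj₁-zip (x ∷ xs) (y ∷ ys) eq = cong (x ∷_) (map-proj₁-zip xs ys (suc-injective eq))

map-proj₂-zip : ∀ {F : Set} (xs : List E) (ys : List F) → length xs ≡ length ys → map proj₂ (zip xs ys) ≡ ys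
map-proj₂-zip []       []       _  = refl
map-proj₂-zip (x ∷ xs) (y ∷ ys) eq = cong (y ∷_) (map-proj₂-zip xs ys (suc-injective eq))

indexed-values : ∀ π → map proj₂ (indexed π) ≡ π
indexed-values π = map-proj₂-zip (oneToN (length π)) π (length-run 0 (length π))

indexed-positions : ∀ {n π} → IsPerm n π → map proj₁ (indexed π) ≡ oneToN n
indexed-positions {n} {π} π↭ = trans (map-proj₁-zip (oneToN (length π)) π (length-run 0 (length π)))
  (cong oneToN (trans (↭-length π↭) (length-run 0 n)))

mainTheorem1 : (n : ℕ) (π : List ℕ) → IsPerm n π → PlusIrreducible π →
    (i j k : ℕ) → 1 ≤ i → i ≤ j → j ≤ k → k ≤ n →
    (IsPerm (n + 3) (tilde i j k π) × PlusIrreducible (tilde i j k π))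
    × (head π ≡ just 1 → last π ≡ just n →
       head (tilde i j k π) ≡ just 1 × last (tilde i j k π) ≡ just (n + 3))
mainTheorem1 n π π↭ irreducible (suc i′) j k (s≤s z≤n) i≤j j≤k k≤n
  with d₁ , refl ← m≤n⇒∃[o]m+o≡n i≤j
     | d₂ , refl ← m≤n⇒∃[o]m+o≡n j≤k
     | d₃ , refl ← m≤n⇒∃[o]m+o≡n k≤n
  = (↭-trans (proj₁ (proj₁ swap)) (subst (λ N → inflation X ↭ oneToN N) total (inflation-↭ n X values↭)) ,
     proj₂ (proj₁ swap)) ,
    λ head≡ last≡ →
      trans (proj₁ (proj₂ swap)) (head-inflation X values↭ (trans (cong head (indexed-values π)) head≡)) ,
      trans (proj₂ (proj₂ swap)) (trans (last-inflation X values↭ (trans (cong last (indexed-values π)) last≡)) (cong just total))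
  where
  open Runs (mult (suc i′) (suc i′ + d₁) (suc i′ + d₁ + d₂))
  X : List (ℕ × ℕ)
  X = indexed π
  values↭ : map value X ↭ oneToN n
  values↭ = subst (_↭ oneToN n) (sym (indexed-values π)) π↭
  marks≡ : runMarks (mult (suc i′) (suc i′ + d₁) (suc i′ + d₁ + d₂)) (map proj₁ X) ≡ cutMarks (suc i′) d₁ d₂ d₃
  marks≡ = trans (cong (runMarks _) (indexed-positions π↭)) (runMarks-mult i′ d₁ d₂ d₃)
  total : totalWeight X ≡ n + 3
  total = trans (totalWeight-runMarks X) (trans (cong length marks≡) (length-cutMarks (suc i′) d₁ d₂ d₃))
  swap : let σ′ = tilde (suc i′) (suc i′ + d₁) (suc i′ + d₁ + d₂) π in
    (σ′ ↭ inflation X × PlusIrreducible σ′) × (head σ′ ≡ head (inflation X) × last σ′ ≡ last (inflation X))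
  swap = blockTransposition-inflation values↭ (subst PlusIrreducible (sym (indexed-values π)) irreducible) i′ d₁ d₂ d₃ marks≡
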